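{- Let $a<b$ be coprime positive integers and suppose the gap sequence of $U(a,b)$ is eventually periodic with computable witnesses: there is an algorithm that, given $(a,b)$, outputs a threshold $N$ and a period $p\ge1$ such that $g_{k+p}=g_k$ for all $k\ge N$. Then: (i) the density $d(U(a,b))=\lim_{n\to\infty}|U(a,b)\cap[0,n]|/n$ exists and is computable (as a rational number) from the witnesses; (ii) the theory $\mathrm{Th}(\mathbb{N},+,0,1,\mathrm{Ulam}_{a,b})$ is decidable; (iii) membership in any subset of $\mathbb{N}^k$ definable in $(\mathbb{N},+,0,1,\mathrm{Ulam}_{a,b})$ is decidable, uniformly in the defining formula.
   Context: For positive integers $a<b$, the Ulam sequence $U(a,b)$ is the increasing sequence $(u_k)_{k\ge1}$ with $u_1=a$, $u_2=b$, and for $k\ge3$, $u_k$ is the least $n>u_{k-1}$ having exactly one representation $n=u_i+u_j$ with $1\le i<j<k$; $g_k=u_{k+1}-u_k$. $\mathrm{Ulam}_{a,b}$ is a unary predicate interpreted as $U(a,b)$. -}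

module Defs where

open import Data.Nat using (ℕ; zero; suc; _+_; _∸_; _≤_; _<_; _≤?_)
open import Data.Fin using (Fin)
open import Data.List using (List; length; filter; upTo)
open import Data.Product using (Σ; ∃; _×_; _,_)
open import Data.Sum using (_⊎_)
open import Data.Empty using (⊥)
open import Data.Unit using (⊤)
open import Relation.Nullary using (¬_)
open import Relation.Binary.PropositionalEquality using (_≡_)

-- Sequences are 0-indexed here: u 0 = a, u 1 = b (paper: u_1 = a, u_2 = b).

UniqueRep : (ℕ → ℕ) → ℕ → ℕ → Set
UniqueRep u k n =
  Σ ℕ λ i → Σ ℕ λ j → (i < j) × (j < k) × (u i + u j ≡ n) ×
    (∀ i′ j′ → i′ < j′ → j′ < k → u i′ + u j′ ≡ n → (i′ ≡ i) × (j′ ≡ j))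

IsUlam : ℕ → ℕ → (ℕ → ℕ) → Set
IsUlam a b u =
  (u 0 ≡ a) × (u 1 ≡ b) ×
  (∀ k → 2 ≤ k →
     (u (k ∸ 1) < u k) × UniqueRep u k (u k) ×
     (∀ m → u (k ∸ 1) < m → m < u k → ¬ UniqueRep u k m))

gap : (ℕ → ℕ) → ℕ → ℕ
gap u k = u (suc k) ∸ u k

GapsPeriodic : (ℕ → ℕ) → ℕ → ℕ → Set
GapsPeriodic u N p = (1 ≤ p) × (∀ k → N ≤ k → gap u (k + p) ≡ gap u k)

-- |U ∩ [0,n]| : since u is strictly increasing with u 0 ≥ 1, we have u k > k,
-- so the terms ≤ n are among u 0 … u n; count those.
countUpTo : (ℕ → ℕ) → ℕ → ℕ
countUpTo u n = length (filter (λ k → u k ≤? n) (upTo (suc n)))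

data Term (n : ℕ) : Set where
  var  : Fin n → Term n
  `0   : Term n
  `1   : Term n
  _`+_ : Term n → Term n → Term n

data Formula : ℕ → Set where
  _`≡_  : ∀ {n} → Term n → Term n → Formula n
  `Ulam : ∀ {n} → Term n → Formula n
  `⊥    : ∀ {n} → Formula n
  `¬_   : ∀ {n} → Formula n → Formula n
  _`∧_  : ∀ {n} → Formula n → Formula n → Formula n
  _`∨_  : ∀ {n} → Formula n → Formula n → Formula n
  _`⇒_  : ∀ {n} → Formula n → Formula n → Formula n
  `∀_   : ∀ {n} → Formula (suc n) → Formula n
  `∃_   : ∀ {n} → Formula (suc n) → Formula n

extend : ∀ {n} → ℕ → (Fin n → ℕ) → Fin (suc n) → ℕ
extend x ρ Fin.zero    = x
extend x ρ (Fin.suc i) = ρ i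

evalT : ∀ {n} → (Fin n → ℕ) → Term n → ℕ
evalT ρ (var i)  = ρ i
evalT ρ `0       = 0
evalT ρ `1       = 1
evalT ρ (s `+ t) = evalT ρ s + evalT ρ t

Sat : (ℕ → ℕ) → ∀ {n} → Formula n → (Fin n → ℕ) → Set
Sat u (s `≡ t) ρ = evalT ρ s ≡ evalT ρ t
Sat u (`Ulam t) ρ = ∃ λ k → u k ≡ evalT ρ t
Sat u `⊥ ρ = ⊥
Sat u (`¬ φ) ρ = ¬ Sat u φ ρ
Sat u (φ `∧ ψ) ρ = Sat u φ ρ × Sat u ψ ρ
Sat u (φ `∨ ψ) ρ = Sat u φ ρ ⊎ Sat u ψ ρ
Sat u (φ `⇒ ψ) ρ = Sat u φ ρ → Sat u ψ ρ
Sat u (`∀ φ) ρ = ∀ x → Sat u φ (extend x ρ)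
Sat u (`∃ φ) ρ = ∃ λ x → Sat u φ (extend x ρ)

emptyEnv : Fin 0 → ℕ
emptyEnv ()

-- From the index N on, the gaps of u repeat with period p, so u (k + p) = u k + D for k ≥ N,
-- where D = u (N + p) - u N > 0.  Hence above T = u N membership in U(a,b) is periodic with
-- period D, and Ulam t is equivalent to a quantifier-free formula built from order and
-- congruence atoms.  Cooper's quantifier elimination (∃ x φ holds iff φ holds "at -∞", which is
-- periodic modulo a common multiple δ of the divisors in φ, or at one of finitely many points
-- just above a lower bound for x) turns every formula of (ℕ, +, 0, 1, Ulam) into such a
-- quantifier-free one, whose truth is decidable.  For the density, the number c(n) of terms up
-- to n satisfies c(n + D) = c(n) + p above T, so ∣ D c(n) - p n ∣ is eventually periodic, hence
-- bounded, and c(n) / n → p / D.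
{-# OPTIONS --safe #-}
module Submission where

open import Data.Nat as ℕ using (ℕ; suc)
open import Data.Product using (∃-syntax)
open import Function.Bundles using (_⇔_)
open import Relation.Nullary using (Dec)
open import Relation.Binary.PropositionalEquality using (_≡_)
open import Defs using (GapsPeriodic)

module LinearForm where

  open import Data.Nat using (zero)
  open import Data.Integer using (ℤ; 0ℤ; 1ℤ; _+_; _*_; _-_; -_)
  import Data.Integer.Properties as ℤ
  open import Data.Integer.Tactic.RingSolver using (solve-∀)
  open import Data.Fin using (Fin)
  open import Data.Vec using (Vec; []; _∷_; lookup; map; zipWith)
  open import Relation.Binary.PropositionalEquality using (_≡_; refl; cong; cong₂; trans)

  -- The coefficients of x₀ … xₙ₋₁, followed by the constant term.
  Lin : ℕ → Set
  Lin n = Vec ℤ (suc n)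

  eval : ∀ {n} → Vec ℤ n → Lin n → ℤ
  eval []      (k ∷ []) = k
  eval (x ∷ ρ) (c ∷ t)  = c * x + eval ρ t

  const : ∀ {n} → ℤ → Lin n
  const {zero}  k = k ∷ []
  const {suc n} k = 0ℤ ∷ const k

  var : ∀ {n} → Fin n → Lin n
  var Fin.zero    = 1ℤ ∷ const 0ℤ
  var (Fin.suc i) = 0ℤ ∷ var i

  _⊕_ : ∀ {n} → Lin n → Lin n → Lin n
  _⊕_ = zipWith _+_

  scale : ∀ {n} → ℤ → Lin n → Lin n
  scale k = map (k *_)

  _⊝_ : ∀ {n} → Lin n → Lin n → Lin n
  s ⊝ t = s ⊕ scale (- 1ℤ) t

  eval-const : ∀ {n} (ρ : Vec ℤ n) k → eval ρ (const k) ≡ k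
  eval-const []      k = refl
  eval-const (x ∷ ρ) k = trans (cong₂ _+_ (ℤ.*-zeroˡ x) (eval-const ρ k)) (ℤ.+-identityˡ k)

  eval-var : ∀ {n} (ρ : Vec ℤ n) i → eval ρ (var i) ≡ lookup ρ i
  eval-var (x ∷ ρ) Fin.zero    = trans (cong₂ _+_ (ℤ.*-identityˡ x) (eval-const ρ 0ℤ)) (ℤ.+-identityʳ x)
  eval-var (x ∷ ρ) (Fin.suc i) = trans (cong₂ _+_ (ℤ.*-zeroˡ x) (eval-var ρ i)) (ℤ.+-identityˡ (lookup ρ i))

  eval-⊕ : ∀ {n} (ρ : Vec ℤ n) s t → eval ρ (s ⊕ t) ≡ eval ρ s + eval ρ t
  eval-⊕ []      (a ∷ []) (b ∷ []) = refl
  eval-⊕ (x ∷ ρ) (a ∷ s)  (b ∷ t)  =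
    trans (cong ((a + b) * x +_) (eval-⊕ ρ s t)) (rearrange a b x (eval ρ s) (eval ρ t))
    where
    rearrange : ∀ a b x p q → (a + b) * x + (p + q) ≡ (a * x + p) + (b * x + q)
    rearrange = solve-∀

  eval-scale : ∀ {n} (ρ : Vec ℤ n) k t → eval ρ (scale k t) ≡ k * eval ρ t
  eval-scale []      k (a ∷ []) = refl
  eval-scale (x ∷ ρ) k (a ∷ t)  =
    trans (cong (k * a * x +_) (eval-scale ρ k t)) (factor k a x (eval ρ t))
    where
    factor : ∀ k a x p → k * a * x + k * p ≡ k * (a * x + p)
    factor = solve-∀

  eval-⊝ : ∀ {n} (ρ : Vec ℤ n) s t → eval ρ (s ⊝ t) ≡ eval ρ s - eval ρ t
  eval-⊝ ρ s t = trans (eval-⊕ ρ s (scale (- 1ℤ) t))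
    (cong (eval ρ s +_) (trans (eval-scale ρ (- 1ℤ) t) (ℤ.-1*i≡-i (eval ρ t))))

module QuantifierFree where

  open import Data.Nat using (zero)
  import Data.Nat.Properties as ℕ
  open import Data.Integer using (ℤ; +_; +[1+_]; -[1+_]; 0ℤ; 1ℤ; _+_; _-_; _≤_; _<_; _<?_; +<+; +≤+)
  import Data.Integer.Properties as ℤ
  open import Data.Integer.Divisibility.Signed using (_∣_; _∣?_)
  open import Data.Vec using (Vec)
  open import Data.List using (List; []; _∷_)
  open import Data.List.Relation.Unary.Any using (Any; here; there)
  open import Data.Product using (_×_; _,_; proj₂)
  open import Data.Sum using (_⊎_; inj₁; inj₂; [_,_])
  open import Data.Empty using (⊥; ⊥-elim)
  open import Data.Unit using (⊤; tt)
  open import Function using (id; _∘_)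
  open import Function.Bundles using (mk⇔; Equivalence)
  import Function.Properties.Equivalence as ⇔
  open import Relation.Nullary using (¬_; yes; no; _×-dec_; _⊎-dec_; ¬?)
  open import Relation.Nullary.Decidable using (decidable-stable)
  open import Relation.Binary.PropositionalEquality using (refl; sym; trans; cong; subst)
  open Equivalence using (to; from)
  open LinearForm

  -- Divisors are stored as d and mean suc d, so that they are never 0.
  data QF (n : ℕ) : Set where
    true false : QF n
    _∧_ _∨_    : QF n → QF n → QF n
    pos        : Lin n → QF n
    dvd ndvd   : ℕ → Lin n → QF n

  infixr 6 _∧_
  infixr 5 _∨_

  ⟦_⟧ : ∀ {n} → QF n → Vec ℤ n → Set
  ⟦ true ⟧     ρ = ⊤
  ⟦ false ⟧    ρ = ⊥
  ⟦ φ ∧ ψ ⟧    ρ = ⟦ φ ⟧ ρ × ⟦ ψ ⟧ ρ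
  ⟦ φ ∨ ψ ⟧    ρ = ⟦ φ ⟧ ρ ⊎ ⟦ ψ ⟧ ρ
  ⟦ pos t ⟧    ρ = 0ℤ < eval ρ t
  ⟦ dvd d t ⟧  ρ = + suc d ∣ eval ρ t
  ⟦ ndvd d t ⟧ ρ = ¬ (+ suc d ∣ eval ρ t)

  ⟦_⟧? : ∀ {n} (φ : QF n) ρ → Dec (⟦ φ ⟧ ρ)
  ⟦ true ⟧?     ρ = yes tt
  ⟦ false ⟧?    ρ = no λ ()
  ⟦ φ ∧ ψ ⟧?    ρ = ⟦ φ ⟧? ρ ×-dec ⟦ ψ ⟧? ρ
  ⟦ φ ∨ ψ ⟧?    ρ = ⟦ φ ⟧? ρ ⊎-dec ⟦ ψ ⟧? ρ
  ⟦ pos t ⟧?    ρ = 0ℤ <? eval ρ t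
  ⟦ dvd d t ⟧?  ρ = + suc d ∣? eval ρ t
  ⟦ ndvd d t ⟧? ρ = ¬? (+ suc d ∣? eval ρ t)

  negate : ∀ {n} → QF n → QF n
  negate true       = false
  negate false      = true
  negate (φ ∧ ψ)    = negate φ ∨ negate ψ
  negate (φ ∨ ψ)    = negate φ ∧ negate ψ
  negate (pos t)    = pos (const 1ℤ ⊝ t)
  negate (dvd d t)  = ndvd d t
  negate (ndvd d t) = dvd d t

  0<1-i⇔i≯0 : ∀ i → (0ℤ < 1ℤ - i) ⇔ (¬ 0ℤ < i)
  0<1-i⇔i≯0 (+ zero)     = mk⇔ (λ { _ (+<+ ()) }) (λ _ → +<+ (ℕ.s≤s ℕ.z≤n))
  0<1-i⇔i≯0 +[1+ zero ]  = mk⇔ (λ { (+<+ ()) }) (λ i≯0 → ⊥-elim (i≯0 (+<+ (ℕ.s≤s ℕ.z≤n))))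
  0<1-i⇔i≯0 +[1+ suc n ] = mk⇔ (λ ()) (λ i≯0 → ⊥-elim (i≯0 (+<+ (ℕ.s≤s ℕ.z≤n))))
  0<1-i⇔i≯0 -[1+ n ]     = mk⇔ (λ _ ()) (λ _ → +<+ (ℕ.s≤s ℕ.z≤n))

  negate-correct : ∀ {n} (φ : QF n) ρ → ⟦ negate φ ⟧ ρ ⇔ (¬ ⟦ φ ⟧ ρ)
  negate-correct true       ρ = mk⇔ (λ ()) (λ ¬⊤ → ¬⊤ tt)
  negate-correct false      ρ = mk⇔ (λ _ ()) (λ _ → tt)
  negate-correct (φ ∧ ψ)    ρ = mk⇔
    [ (λ ¬φ (p , _) → to (negate-correct φ ρ) ¬φ p) , (λ ¬ψ (_ , q) → to (negate-correct ψ ρ) ¬ψ q) ]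
    (by-cases (⟦ φ ⟧? ρ))
    where
    by-cases : Dec (⟦ φ ⟧ ρ) → ¬ ⟦ φ ∧ ψ ⟧ ρ → ⟦ negate (φ ∧ ψ) ⟧ ρ
    by-cases (yes p) ¬φψ = inj₂ (from (negate-correct ψ ρ) λ q → ¬φψ (p , q))
    by-cases (no ¬p) _   = inj₁ (from (negate-correct φ ρ) ¬p)
  negate-correct (φ ∨ ψ)    ρ = mk⇔
    (λ (¬φ , ¬ψ) → [ to (negate-correct φ ρ) ¬φ , to (negate-correct ψ ρ) ¬ψ ])
    (λ ¬φψ → from (negate-correct φ ρ) (¬φψ ∘ inj₁) , from (negate-correct ψ ρ) (¬φψ ∘ inj₂))
  negate-correct (pos t)    ρ =
    subst (λ i → (0ℤ < i) ⇔ (¬ 0ℤ < eval ρ t)) (sym eval-1⊝t) (0<1-i⇔i≯0 (eval ρ t))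
    where
    eval-1⊝t : eval ρ (const 1ℤ ⊝ t) ≡ 1ℤ - eval ρ t
    eval-1⊝t = trans (eval-⊝ ρ (const 1ℤ) t) (cong (_- eval ρ t) (eval-const ρ 1ℤ))
  negate-correct (dvd d t)  ρ = mk⇔ id id
  negate-correct (ndvd d t) ρ = mk⇔ (λ p ¬p → ¬p p) (decidable-stable (+ suc d ∣? eval ρ t))

  anyBelow : ∀ {n} → ℕ → (ℕ → QF n) → QF n
  anyBelow zero    f = false
  anyBelow (suc k) f = f k ∨ anyBelow k f

  anyBelow-correct : ∀ {n} k (f : ℕ → QF n) ρ → ⟦ anyBelow k f ⟧ ρ ⇔ (∃[ j ] j ℕ.< k × ⟦ f j ⟧ ρ)
  anyBelow-correct k f ρ = mk⇔ (sound k) (λ (j , j<k , p) → complete k j j<k p)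
    where
    sound : ∀ k → ⟦ anyBelow k f ⟧ ρ → ∃[ j ] j ℕ.< k × ⟦ f j ⟧ ρ
    sound (suc k) (inj₁ p) = k , ℕ.n<1+n k , p
    sound (suc k) (inj₂ p) with sound k p
    ... | j , j<k , q = j , ℕ.m<n⇒m<1+n j<k , q
    complete : ∀ k j → j ℕ.< k → ⟦ f j ⟧ ρ → ⟦ anyBelow k f ⟧ ρ
    complete (suc k) j j<1+k p with j ℕ.≟ k
    ... | yes refl = inj₁ p
    ... | no j≢k   = inj₂ (complete k j (ℕ.≤∧≢⇒< (ℕ.s≤s⁻¹ j<1+k) j≢k) p)

  anyOf : ∀ {n} {A : Set} → List A → (A → QF n) → QF n
  anyOf []       f = false
  anyOf (a ∷ as) f = f a ∨ anyOf as f

  anyOf-correct : ∀ {n} {A : Set} (as : List A) (f : A → QF n) ρ →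
    ⟦ anyOf as f ⟧ ρ ⇔ Any (λ a → ⟦ f a ⟧ ρ) as
  anyOf-correct as f ρ = mk⇔ (sound as) (complete as)
    where
    sound : ∀ as → ⟦ anyOf as f ⟧ ρ → Any (λ a → ⟦ f a ⟧ ρ) as
    sound (a ∷ as) (inj₁ p) = here p
    sound (a ∷ as) (inj₂ p) = there (sound as p)
    complete : ∀ as → Any (λ a → ⟦ f a ⟧ ρ) as → ⟦ anyOf as f ⟧ ρ
    complete (a ∷ as) (here p)  = inj₁ p
    complete (a ∷ as) (there p) = inj₂ (complete as p)

  _≼_ _≐_ : ∀ {n} → Lin n → Lin n → QF n
  s ≼ t = pos (const 1ℤ ⊕ (t ⊝ s))
  s ≐ t = s ≼ t ∧ t ≼ s

  0<1+i⇔0≤i : ∀ i → (0ℤ < 1ℤ + i) ⇔ (0ℤ ≤ i)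
  0<1+i⇔0≤i (+ n)        = mk⇔ (λ _ → +≤+ ℕ.z≤n) (λ _ → +<+ (ℕ.s≤s ℕ.z≤n))
  0<1+i⇔0≤i -[1+ zero ]  = mk⇔ (λ { (+<+ ()) }) (λ ())
  0<1+i⇔0≤i -[1+ suc n ] = mk⇔ (λ ()) (λ ())

  ≼-correct : ∀ {n} (s t : Lin n) ρ → ⟦ s ≼ t ⟧ ρ ⇔ (eval ρ s ≤ eval ρ t)
  ≼-correct s t ρ rewrite eval-⊕ ρ (const 1ℤ) (t ⊝ s) | eval-const ρ 1ℤ | eval-⊝ ρ t s =
    ⇔.trans (0<1+i⇔0≤i (eval ρ t - eval ρ s)) (mk⇔ ℤ.0≤i-j⇒j≤i ℤ.i≤j⇒0≤j-i)

  ≐-correct : ∀ {n} (s t : Lin n) ρ → ⟦ s ≐ t ⟧ ρ ⇔ (eval ρ s ≡ eval ρ t)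
  ≐-correct s t ρ = mk⇔
    (λ (s≼t , t≼s) → ℤ.≤-antisym (to (≼-correct s t ρ) s≼t) (to (≼-correct t s ρ) t≼s))
    (λ s≡t → from (≼-correct s t ρ) (ℤ.≤-reflexive s≡t) , from (≼-correct t s ρ) (ℤ.≤-reflexive (sym s≡t)))

  when : ∀ {n} {A : Set} → Dec A → QF n → QF n
  when (yes _) φ = φ
  when (no _)  _ = false

  when-correct : ∀ {n} {A : Set} (A? : Dec A) (φ : QF n) ρ → ⟦ when A? φ ⟧ ρ ⇔ (A × ⟦ φ ⟧ ρ)
  when-correct (yes a) φ ρ = mk⇔ (a ,_) proj₂
  when-correct (no ¬a) φ ρ = mk⇔ (λ ()) (λ (a , _) → ¬a a)

module Cooper where

  open import Data.Nat using (zero)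
  import Data.Nat.Properties as ℕ
  import Data.Nat.Divisibility as ℕ
  open import Data.Integer
    using (ℤ; +_; +[1+_]; -[1+_]; 0ℤ; 1ℤ; _+_; _*_; _-_; -_; ∣_∣; _⊓_; _≤_; _<_; +<+; +≤+; -≤-; -≤+)
  import Data.Integer.Properties as ℤ
  open import Data.Integer.DivMod using (_%ℕ_; _/ℕ_; n%ℕd<d; a≡a%ℕn+[a/ℕn]*n)
  open import Data.Integer.Divisibility.Signed using (_∣_; divides; ∣ᵤ⇒∣)
  import Data.Integer.Divisibility.Signed as ℤ
  open import Data.Integer.Tactic.RingSolver using (solve-∀)
  open import Data.Vec using (Vec; _∷_)
  open import Data.List using (List; []; _∷_; _++_)
  open import Data.List.Relation.Unary.Any using (Any; here; satisfied)
  import Data.List.Relation.Unary.Any as Any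
  open import Data.List.Relation.Unary.Any.Properties using (++⁺ˡ; ++⁺ʳ)
  open import Data.Product using (_×_; _,_)
  open import Data.Product.Function.NonDependent.Propositional using (_×-⇔_)
  open import Data.Sum using (inj₁; inj₂; [_,_])
  open import Data.Sum.Function.Propositional using (_⊎-⇔_)
  open import Data.Empty using (⊥-elim)
  open import Function using (id; _∘_)
  open import Function.Bundles using (mk⇔; Equivalence)
  open import Function.Related.TypeIsomorphisms using (¬-cong-⇔)
  open import Relation.Nullary using (¬_; yes; no)
  open import Relation.Binary.PropositionalEquality using (refl; sym; trans; cong; cong₂; subst)
  open Equivalence using (to; from)
  open LinearForm
  open QuantifierFree

  -- δ φ = suc (δ′ φ) is a common multiple of the divisors in φ; δ′ is chosen so that
  -- δ (φ ∧ ψ) and δ (φ ∨ ψ) reduce to δ φ * δ ψ.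
  δ′ δ : ∀ {n} → QF n → ℕ
  δ φ = suc (δ′ φ)
  δ′ (φ ∧ ψ)    = δ′ ψ ℕ.+ δ′ φ ℕ.* δ ψ
  δ′ (φ ∨ ψ)    = δ′ ψ ℕ.+ δ′ φ ℕ.* δ ψ
  δ′ (dvd d t)  = d
  δ′ (ndvd d t) = d
  δ′ _          = 0

  ∣-shift : ∀ {d D} c x y T → d ∣ D → D ∣ x - y → d ∣ c * x + T → d ∣ c * y + T
  ∣-shift c x y T d∣D D∣x-y d∣cx+T =
    subst (_ ∣_) (shift c x y T) (ℤ.∣m∣n⇒∣m-n d∣cx+T (ℤ.∣n⇒∣m*n c (ℤ.∣-trans d∣D D∣x-y)))
    where
    shift : ∀ c x y T → (c * x + T) - c * (x - y) ≡ c * y + T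
    shift = solve-∀

  ∣-sym-diff : ∀ {D} x y → D ∣ x - y → D ∣ y - x
  ∣-sym-diff x y D∣x-y = subst (_ ∣_) (neg-sub x y) (ℤ.∣m⇒∣-m D∣x-y)
    where
    neg-sub : ∀ x y → - (x - y) ≡ y - x
    neg-sub = solve-∀

  x-[x-y]≡y : ∀ x y → x - (x - y) ≡ y
  x-[x-y]≡y = solve-∀

  D∣x-[x-D] : ∀ x D → D ∣ x - (x - D)
  D∣x-[x-D] x D = ℤ.∣-reflexive (sym (x-[x-y]≡y x D))

  minusInf : ∀ {n} → QF (suc n) → QF (suc n)
  minusInf (φ ∧ ψ)              = minusInf φ ∧ minusInf ψ
  minusInf (φ ∨ ψ)              = minusInf φ ∨ minusInf ψ
  minusInf (pos (+[1+ m ] ∷ t)) = false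
  minusInf (pos (-[1+ m ] ∷ t)) = true
  minusInf φ                    = φ

  minusInf-periodic : ∀ {n} (φ : QF (suc n)) {D} ρ x y → δ φ ℕ.∣ D → + D ∣ x - y →
    ⟦ minusInf φ ⟧ (x ∷ ρ) → ⟦ minusInf φ ⟧ (y ∷ ρ)
  minusInf-periodic true                  ρ x y δ∣D D∣x-y p = p
  minusInf-periodic (φ ∧ ψ)               ρ x y δ∣D D∣x-y (p , q) =
    minusInf-periodic φ ρ x y (ℕ.m*n∣⇒m∣ (δ φ) (δ ψ) δ∣D) D∣x-y p ,
    minusInf-periodic ψ ρ x y (ℕ.m*n∣⇒n∣ (δ φ) (δ ψ) δ∣D) D∣x-y q
  minusInf-periodic (φ ∨ ψ)               ρ x y δ∣D D∣x-y (inj₁ p) =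
    inj₁ (minusInf-periodic φ ρ x y (ℕ.m*n∣⇒m∣ (δ φ) (δ ψ) δ∣D) D∣x-y p)
  minusInf-periodic (φ ∨ ψ)               ρ x y δ∣D D∣x-y (inj₂ q) =
    inj₂ (minusInf-periodic ψ ρ x y (ℕ.m*n∣⇒n∣ (δ φ) (δ ψ) δ∣D) D∣x-y q)
  -- + 0 * x reduces to + 0, so an atom with x-coefficient + 0 has the same value at every x.
  minusInf-periodic (pos (+ zero ∷ t))    ρ x y δ∣D D∣x-y p = p
  minusInf-periodic (pos (-[1+ m ] ∷ t))  ρ x y δ∣D D∣x-y p = p
  minusInf-periodic (dvd d (c ∷ t))       ρ x y δ∣D D∣x-y p =
    ∣-shift c x y (eval ρ t) (∣ᵤ⇒∣ δ∣D) D∣x-y p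
  minusInf-periodic (ndvd d (c ∷ t))      ρ x y δ∣D D∣x-y p q =
    p (∣-shift c y x (eval ρ t) (∣ᵤ⇒∣ δ∣D) (∣-sym-diff x y D∣x-y) q)

  pos-beyond : ∀ m k T → ∣ T ∣ ℕ.≤ k → 0ℤ < +[1+ m ] * +[1+ k ] + T
  pos-beyond m k (+ t)    _      = +<+ (ℕ.s≤s ℕ.z≤n)
  pos-beyond m k -[1+ t ] 1+t≤k  =
    subst (0ℤ <_) (sym (ℤ.⊖-≥ (ℕ.s≤s (ℕ.<⇒≤ t<a)))) (+<+ (ℕ.m<n⇒0<n∸m (ℕ.s≤s t<a)))
    where
    t<a : t ℕ.< k ℕ.+ m ℕ.* suc k
    t<a = ℕ.≤-trans 1+t≤k (ℕ.m≤m+n k _)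

  pos-beyond-neg : ∀ m k T → ∣ T ∣ ℕ.≤ k → ¬ 0ℤ < +[1+ m ] * -[1+ k ] + T
  pos-beyond-neg m k T ∣T∣≤k 0<v = ℤ.<-asym
    (ℤ.neg-mono-< (pos-beyond m k (- T) (subst (ℕ._≤ k) (sym (ℤ.∣-i∣≡∣i∣ T)) ∣T∣≤k)))
    (subst (0ℤ <_) (flip-sign +[1+ m ] +[1+ k ] T) 0<v)
    where
    flip-sign : ∀ a b T → a * - b + T ≡ - (a * b + - T)
    flip-sign = solve-∀

  minusInf-agrees : ∀ {n} (φ : QF (suc n)) ρ →
    ∃[ Z ] ∀ x → x ≤ Z → ⟦ minusInf φ ⟧ (x ∷ ρ) ⇔ ⟦ φ ⟧ (x ∷ ρ)
  minusInf-agrees (φ ∧ ψ) ρ with minusInf-agrees φ ρ | minusInf-agrees ψ ρ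
  ... | Z₁ , agree₁ | Z₂ , agree₂ = Z₁ ⊓ Z₂ , λ x x≤Z →
    agree₁ x (ℤ.≤-trans x≤Z (ℤ.i⊓j≤i Z₁ Z₂)) ×-⇔ agree₂ x (ℤ.≤-trans x≤Z (ℤ.i⊓j≤j Z₁ Z₂))
  minusInf-agrees (φ ∨ ψ) ρ with minusInf-agrees φ ρ | minusInf-agrees ψ ρ
  ... | Z₁ , agree₁ | Z₂ , agree₂ = Z₁ ⊓ Z₂ , λ x x≤Z →
    agree₁ x (ℤ.≤-trans x≤Z (ℤ.i⊓j≤i Z₁ Z₂)) ⊎-⇔ agree₂ x (ℤ.≤-trans x≤Z (ℤ.i⊓j≤j Z₁ Z₂))
  minusInf-agrees (pos (+[1+ m ] ∷ t)) ρ = -[1+ ∣ eval ρ t ∣ ] , λ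
    { -[1+ k ] (-≤- ∣T∣≤k) → mk⇔ (λ ()) (pos-beyond-neg m k (eval ρ t) ∣T∣≤k) }
  minusInf-agrees (pos (-[1+ m ] ∷ t)) ρ = -[1+ ∣ eval ρ t ∣ ] , λ
    { -[1+ k ] (-≤- ∣T∣≤k) → mk⇔ (λ _ → pos-beyond m k (eval ρ t) ∣T∣≤k) _ }
  minusInf-agrees true                 ρ = 0ℤ , λ _ _ → mk⇔ id id
  minusInf-agrees false                ρ = 0ℤ , λ _ _ → mk⇔ id id
  minusInf-agrees (pos (+ zero ∷ t))   ρ = 0ℤ , λ _ _ → mk⇔ id id
  minusInf-agrees (dvd d t)            ρ = 0ℤ , λ _ _ → mk⇔ id id
  minusInf-agrees (ndvd d t)           ρ = 0ℤ , λ _ _ → mk⇔ id id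

  -- φ with x := e / suc m: every atom c x + t is multiplied by suc m, and so is every divisor,
  -- since suc (d + m * suc d) = suc m * suc d.
  substQuot : ∀ {n} → ℕ → Lin n → QF (suc n) → QF n
  substQuot m e true             = true
  substQuot m e false            = false
  substQuot m e (φ ∧ ψ)          = substQuot m e φ ∧ substQuot m e ψ
  substQuot m e (φ ∨ ψ)          = substQuot m e φ ∨ substQuot m e ψ
  substQuot m e (pos (c ∷ t))    = pos (scale c e ⊕ scale (+ suc m) t)
  substQuot m e (dvd d (c ∷ t))  = dvd (d ℕ.+ m ℕ.* suc d) (scale c e ⊕ scale (+ suc m) t)
  substQuot m e (ndvd d (c ∷ t)) = ndvd (d ℕ.+ m ℕ.* suc d) (scale c e ⊕ scale (+ suc m) t)

  eval-substQuot : ∀ {n} m e c t (ρ : Vec ℤ n) x → + suc m * x ≡ eval ρ e →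
    eval ρ (scale c e ⊕ scale (+ suc m) t) ≡ + suc m * (c * x + eval ρ t)
  eval-substQuot m e c t ρ x sx≡e = begin
    eval ρ (scale c e ⊕ scale (+ suc m) t)          ≡⟨ eval-⊕ ρ (scale c e) (scale (+ suc m) t) ⟩
    eval ρ (scale c e) + eval ρ (scale (+ suc m) t) ≡⟨ cong₂ _+_ (eval-scale ρ c e) (eval-scale ρ (+ suc m) t) ⟩
    c * eval ρ e + + suc m * eval ρ t               ≡⟨ cong (λ z → c * z + + suc m * eval ρ t) (sym sx≡e) ⟩
    c * (+ suc m * x) + + suc m * eval ρ t          ≡⟨ distrib (+ suc m) c x (eval ρ t) ⟩
    + suc m * (c * x + eval ρ t)                    ∎
    where
    open Relation.Binary.PropositionalEquality.≡-Reasoning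
    distrib : ∀ s c x T → c * (s * x) + s * T ≡ s * (c * x + T)
    distrib = solve-∀

  0<*⇔0< : ∀ m v → (0ℤ < +[1+ m ] * v) ⇔ (0ℤ < v)
  0<*⇔0< m v = mk⇔
    (λ 0<sv → ℤ.*-cancelˡ-<-nonNeg +[1+ m ] (subst (_< +[1+ m ] * v) (sym (ℤ.*-zeroʳ +[1+ m ])) 0<sv))
    (λ 0<v → subst (_< +[1+ m ] * v) (ℤ.*-zeroʳ +[1+ m ]) (ℤ.*-monoˡ-<-pos +[1+ m ] 0<v))

  *∣*⇔∣ : ∀ m d v → (+[1+ m ] * +[1+ d ] ∣ +[1+ m ] * v) ⇔ (+[1+ d ] ∣ v)
  *∣*⇔∣ m d v = mk⇔ (ℤ.*-cancelˡ-∣ +[1+ m ]) (ℤ.*-monoʳ-∣ +[1+ m ])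

  substQuot-correct : ∀ {n} m e (φ : QF (suc n)) ρ x → + suc m * x ≡ eval ρ e →
    ⟦ substQuot m e φ ⟧ ρ ⇔ ⟦ φ ⟧ (x ∷ ρ)
  substQuot-correct m e true             ρ x sx≡e = mk⇔ id id
  substQuot-correct m e false            ρ x sx≡e = mk⇔ id id
  substQuot-correct m e (φ ∧ ψ)          ρ x sx≡e =
    substQuot-correct m e φ ρ x sx≡e ×-⇔ substQuot-correct m e ψ ρ x sx≡e
  substQuot-correct m e (φ ∨ ψ)          ρ x sx≡e =
    substQuot-correct m e φ ρ x sx≡e ⊎-⇔ substQuot-correct m e ψ ρ x sx≡e
  substQuot-correct m e (pos (c ∷ t))    ρ x sx≡e
    rewrite eval-substQuot m e c t ρ x sx≡e = 0<*⇔0< m (c * x + eval ρ t)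
  substQuot-correct m e (dvd d (c ∷ t))  ρ x sx≡e
    rewrite eval-substQuot m e c t ρ x sx≡e = *∣*⇔∣ m d (c * x + eval ρ t)
  substQuot-correct m e (ndvd d (c ∷ t)) ρ x sx≡e
    rewrite eval-substQuot m e c t ρ x sx≡e = ¬-cong-⇔ (*∣*⇔∣ m d (c * x + eval ρ t))

  lowerBounds : ∀ {n} → QF (suc n) → List (ℕ × Lin n)
  lowerBounds (φ ∧ ψ)              = lowerBounds φ ++ lowerBounds ψ
  lowerBounds (φ ∨ ψ)              = lowerBounds φ ++ lowerBounds ψ
  lowerBounds (pos (+[1+ m ] ∷ t)) = (m , t) ∷ []
  lowerBounds _                    = []

  -- x satisfies the bound 0 < suc m * x + t, but x - D does not.
  JustAbove : ∀ {n} → Vec ℤ n → ℕ → ℤ → ℕ × Lin n → Set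
  JustAbove ρ D x (m , t) = ∃[ j ] j ℕ.< suc m ℕ.* D × + suc m * x ≡ +[1+ j ] - eval ρ t

  0<⇒+[1+] : ∀ {v} → 0ℤ < v → ∃[ j ] v ≡ +[1+ j ]
  0<⇒+[1+] {+[1+ j ]} _ = j , refl
  0<⇒+[1+] {+ zero} (+<+ ())

  crossing-pos : ∀ m D T x → 0ℤ < +[1+ m ] * x + T → ¬ 0ℤ < +[1+ m ] * (x - + D) + T →
    ∃[ j ] j ℕ.< suc m ℕ.* D × +[1+ m ] * x ≡ +[1+ j ] - T
  crossing-pos m D T x 0<v ¬0<v′ with 0<⇒+[1+] 0<v
  ... | j , v≡1+j = j , ℤ.drop‿+≤+ (ℤ.i-j≤0⇒i≤j v′≤0) , isolate +[1+ m ] x T +[1+ j ] v≡1+j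
    where
    shift-down : ∀ s x T D → s * (x - D) + T ≡ (s * x + T) - s * D
    shift-down = solve-∀
    v′≤0 : +[1+ j ] - + (suc m ℕ.* D) ≤ 0ℤ
    v′≤0 = subst (_≤ 0ℤ)
      (trans (shift-down +[1+ m ] x T (+ D)) (cong₂ _-_ v≡1+j (sym (ℤ.pos-* (suc m) D))))
      (ℤ.≮⇒≥ ¬0<v′)
    isolate : ∀ s x T v → s * x + T ≡ v → s * x ≡ v - T
    isolate s x T v refl = cancel s x T
      where
      cancel : ∀ s x T → s * x ≡ (s * x + T) - T
      cancel = solve-∀

  leaving-crosses-lowerBound : ∀ {n} (φ : QF (suc n)) {D} ρ x → δ φ ℕ.∣ D →
    ⟦ φ ⟧ (x ∷ ρ) → ¬ ⟦ φ ⟧ (x - + D ∷ ρ) → Any (JustAbove ρ D x) (lowerBounds φ)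
  leaving-crosses-lowerBound true ρ x δ∣D p ¬p′ = ⊥-elim (¬p′ p)
  leaving-crosses-lowerBound (φ ∧ ψ) {D} ρ x δ∣D (p , q) ¬pq′ with ⟦ φ ⟧? (x - + D ∷ ρ)
  ... | yes p′ = ++⁺ʳ (lowerBounds φ)
    (leaving-crosses-lowerBound ψ ρ x (ℕ.m*n∣⇒n∣ (δ φ) (δ ψ) δ∣D) q λ q′ → ¬pq′ (p′ , q′))
  ... | no ¬p′ = ++⁺ˡ (leaving-crosses-lowerBound φ ρ x (ℕ.m*n∣⇒m∣ (δ φ) (δ ψ) δ∣D) p ¬p′)
  leaving-crosses-lowerBound (φ ∨ ψ) ρ x δ∣D (inj₁ p) ¬pq′ =
    ++⁺ˡ (leaving-crosses-lowerBound φ ρ x (ℕ.m*n∣⇒m∣ (δ φ) (δ ψ) δ∣D) p (¬pq′ ∘ inj₁))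
  leaving-crosses-lowerBound (φ ∨ ψ) ρ x δ∣D (inj₂ q) ¬pq′ = ++⁺ʳ (lowerBounds φ)
    (leaving-crosses-lowerBound ψ ρ x (ℕ.m*n∣⇒n∣ (δ φ) (δ ψ) δ∣D) q (¬pq′ ∘ inj₂))
  leaving-crosses-lowerBound (pos (+ zero ∷ t)) ρ x δ∣D p ¬p′ = ⊥-elim (¬p′ p)
  leaving-crosses-lowerBound (pos (+[1+ m ] ∷ t)) {D} ρ x δ∣D p ¬p′ =
    here (crossing-pos m D (eval ρ t) x p ¬p′)
  leaving-crosses-lowerBound (pos (-[1+ m ] ∷ t)) {D} ρ x δ∣D p ¬p′ =
    ⊥-elim (¬p′ (ℤ.<-≤-trans p (subst (_≤ -[1+ m ] * (x - + D) + eval ρ t) (ℤ.+-identityʳ _) v≤v′)))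
    where
    shift-up : ∀ s x T D → - s * (x - D) + T ≡ (- s * x + T) + s * D
    shift-up = solve-∀
    v≤v′ : -[1+ m ] * x + eval ρ t + 0ℤ ≤ -[1+ m ] * (x - + D) + eval ρ t
    v≤v′ = subst (_ ≤_) (sym (shift-up +[1+ m ] x (eval ρ t) (+ D)))
      (ℤ.+-monoʳ-≤ (-[1+ m ] * x + eval ρ t) (subst (0ℤ ≤_) (ℤ.pos-* (suc m) D) (+≤+ ℕ.z≤n)))
  leaving-crosses-lowerBound (dvd d (c ∷ t)) {D} ρ x δ∣D p ¬p′ =
    ⊥-elim (¬p′ (∣-shift c x (x - + D) (eval ρ t) (∣ᵤ⇒∣ δ∣D) (D∣x-[x-D] x (+ D)) p))
  leaving-crosses-lowerBound (ndvd d (c ∷ t)) {D} ρ x δ∣D p ¬p′ =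
    ⊥-elim (¬p′ λ q → p (∣-shift c (x - + D) x (eval ρ t) (∣ᵤ⇒∣ δ∣D)
      (∣-sym-diff x (x - + D) (D∣x-[x-D] x (+ D))) q))

  nearBound : ∀ {n} → QF (suc n) → ℕ × Lin n → QF n
  nearBound φ (m , t) = anyBelow (suc m ℕ.* δ φ) λ j →
    dvd m (const +[1+ j ] ⊝ t) ∧ substQuot m (const +[1+ j ] ⊝ t) φ

  minusInfPart lowerBoundPart cooper : ∀ {n} → QF (suc n) → QF n
  minusInfPart φ   = anyBelow (δ φ) λ j → substQuot 0 (const (+ j)) (minusInf φ)
  lowerBoundPart φ = anyOf (lowerBounds φ) (nearBound φ)
  cooper φ         = minusInfPart φ ∨ lowerBoundPart φ

  i≤+∣i∣ : ∀ i → i ≤ + ∣ i ∣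
  i≤+∣i∣ (+ n)    = ℤ.≤-refl
  i≤+∣i∣ -[1+ n ] = -≤+

  far-below : ∀ x Z d → x - + ∣ x - Z ∣ * +[1+ d ] ≤ Z
  far-below x Z d = begin
    x - K * +[1+ d ]  ≤⟨ ℤ.+-monoʳ-≤ x (ℤ.neg-mono-≤ K≤K*[1+d]) ⟩
    x - K             ≤⟨ ℤ.+-monoʳ-≤ x (ℤ.neg-mono-≤ (i≤+∣i∣ (x - Z))) ⟩
    x - (x - Z)       ≡⟨ x-[x-y]≡y x Z ⟩
    Z                 ∎
    where
    open ℤ.≤-Reasoning
    K : ℤ
    K = + ∣ x - Z ∣
    K≤K*[1+d] : K ≤ K * +[1+ d ]
    K≤K*[1+d] = subst (K ≤_) (ℤ.pos-* ∣ x - Z ∣ (suc d)) (+≤+ (ℕ.m≤m*n ∣ x - Z ∣ (suc d)))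

  subst-const : ∀ {n} (φ : QF (suc n)) ρ j → ⟦ substQuot 0 (const (+ j)) φ ⟧ ρ ⇔ ⟦ φ ⟧ (+ j ∷ ρ)
  subst-const φ ρ j = substQuot-correct 0 (const (+ j)) φ ρ (+ j)
    (trans (ℤ.*-identityˡ (+ j)) (sym (eval-const ρ (+ j))))

  minusInfPart-sound : ∀ {n} (φ : QF (suc n)) ρ → ⟦ minusInfPart φ ⟧ ρ → ∃[ x ] ⟦ φ ⟧ (x ∷ ρ)
  minusInfPart-sound φ ρ p with to (anyBelow-correct (δ φ) _ ρ) p | minusInf-agrees φ ρ
  ... | j , _ , q | Z , agree = y , to (agree y (far-below (+ j) Z (δ′ φ))) φ-∞y
    where
    k y : ℤ
    k = + ∣ + j - Z ∣
    y = + j - k * + δ φ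
    φ-∞y : ⟦ minusInf φ ⟧ (y ∷ ρ)
    φ-∞y = minusInf-periodic φ ρ (+ j) y ℕ.∣-refl (divides k (x-[x-y]≡y (+ j) (k * + δ φ)))
      (to (subst-const (minusInf φ) ρ j) q)

  lowerBoundPart-sound : ∀ {n} (φ : QF (suc n)) ρ → ⟦ lowerBoundPart φ ⟧ ρ → ∃[ x ] ⟦ φ ⟧ (x ∷ ρ)
  lowerBoundPart-sound φ ρ p with satisfied (to (anyOf-correct (lowerBounds φ) (nearBound φ) ρ) p)
  ... | (m , t) , q with to (anyBelow-correct (suc m ℕ.* δ φ) _ ρ) q
  ... | j , _ , divides z e≡z*s , sq =
    z , to (substQuot-correct m (const +[1+ j ] ⊝ t) φ ρ z (trans (ℤ.*-comm +[1+ m ] z) (sym e≡z*s))) sq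

  eval-1+j⊝ : ∀ {n} (ρ : Vec ℤ n) j t → eval ρ (const +[1+ j ] ⊝ t) ≡ +[1+ j ] - eval ρ t
  eval-1+j⊝ ρ j t = trans (eval-⊝ ρ (const +[1+ j ]) t) (cong (_- eval ρ t) (eval-const ρ +[1+ j ]))

  nearBound-complete : ∀ {n} (φ : QF (suc n)) ρ y b → ⟦ φ ⟧ (y ∷ ρ) → JustAbove ρ (δ φ) y b →
    ⟦ nearBound φ b ⟧ ρ
  nearBound-complete φ ρ y (m , t) φy (j , j<sδ , sy≡1+j-t) =
    from (anyBelow-correct (suc m ℕ.* δ φ) _ ρ) (j , j<sδ ,
      divides y (trans (eval-1+j⊝ ρ j t) (trans (sym sy≡1+j-t) (ℤ.*-comm +[1+ m ] y))) ,
      from (substQuot-correct m (const +[1+ j ] ⊝ t) φ ρ y (trans sy≡1+j-t (sym (eval-1+j⊝ ρ j t)))) φy)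

  -- A first point on the way down where φ fails would lie just above a lower bound of φ.
  persists-downward : ∀ {n} (φ : QF (suc n)) ρ x → ¬ ⟦ lowerBoundPart φ ⟧ ρ → ⟦ φ ⟧ (x ∷ ρ) →
    ∀ k → ⟦ φ ⟧ (x - + k * + δ φ ∷ ρ)
  persists-downward φ ρ x ¬lb φx zero = subst (λ z → ⟦ φ ⟧ (z ∷ ρ)) (sym (ℤ.+-identityʳ x)) φx
  persists-downward φ ρ x ¬lb φx (suc k) with ⟦ φ ⟧? (x - + k * + δ φ - + δ φ ∷ ρ)
  ... | yes φy = subst (λ z → ⟦ φ ⟧ (z ∷ ρ)) (one-more x (+ k) (+ δ φ)) φy
    where
    one-more : ∀ x k D → x - k * D - D ≡ x - (1ℤ + k) * D
    one-more = solve-∀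
  ... | no ¬φy = ⊥-elim (¬lb (from (anyOf-correct (lowerBounds φ) (nearBound φ) ρ)
    (Any.map (nearBound-complete φ ρ _ _ φx′) (leaving-crosses-lowerBound φ ρ _ ℕ.∣-refl φx′ ¬φy))))
    where
    φx′ : ⟦ φ ⟧ (x - + k * + δ φ ∷ ρ)
    φx′ = persists-downward φ ρ x ¬lb φx k

  cooper-complete : ∀ {n} (φ : QF (suc n)) ρ x → ⟦ φ ⟧ (x ∷ ρ) → ⟦ cooper φ ⟧ ρ
  cooper-complete φ ρ x φx with ⟦ lowerBoundPart φ ⟧? ρ | minusInf-agrees φ ρ
  ... | yes lb  | _         = inj₂ lb
  ... | no ¬lb  | Z , agree = inj₁ (from (anyBelow-correct (δ φ) _ ρ) (r , n%ℕd<d x (δ φ) ,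
    from (subst-const (minusInf φ) ρ r) (minusInf-periodic φ ρ y (+ r) ℕ.∣-refl δ∣y-r
      (from (agree y (far-below x Z (δ′ φ))) (persists-downward φ ρ x ¬lb φx k)))))
    where
    k r : ℕ
    k = ∣ x - Z ∣
    r = x %ℕ δ φ
    y : ℤ
    y = x - + k * + δ φ
    δ∣y-r : + δ φ ∣ y - + r
    δ∣y-r = divides (x /ℕ δ φ - + k)
      (trans (cong (λ x → x - + k * + δ φ - + r) (a≡a%ℕn+[a/ℕn]*n x (δ φ)))
             (regroup (+ r) (x /ℕ δ φ) (+ k) (+ δ φ)))
      where
      regroup : ∀ r q k D → r + q * D - k * D - r ≡ (q - k) * D
      regroup = solve-∀

  cooper-correct : ∀ {n} (φ : QF (suc n)) ρ → ⟦ cooper φ ⟧ ρ ⇔ (∃[ x ] ⟦ φ ⟧ (x ∷ ρ))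
  cooper-correct φ ρ =
    mk⇔ [ minusInfPart-sound φ ρ , lowerBoundPart-sound φ ρ ] λ (x , φx) → cooper-complete φ ρ x φx

module EventuallyPeriodic {P : ℕ → Set} (P? : ∀ x → Dec (P x)) (T D′ : ℕ)
  (P-periodic : ∀ x → T ℕ.≤ x → P x ⇔ P (x ℕ.+ suc D′)) where

  open import Data.Nat using (zero; _+_; _*_; _∸_; _≤_; _<?_)
  open import Data.Nat.Properties using (+-identityʳ; +-assoc; +-comm; ≤-trans; m≤m+n; m+[n∸m]≡n; m+n∸m≡n; ≮⇒≥)
  open import Data.Nat.DivMod using (_%_; _/_; m≡m%n+[m/n]*n; m%n<n)
  open import Data.Nat.Divisibility using (divides) renaming (_∣_ to _ℕ∣_)
  open import Data.Integer using (+_; _-_; _⊖_; +≤+) renaming (_≤_ to _≤ℤ_)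
  import Data.Integer.Properties as ℤ
  open import Data.Integer.Divisibility.Signed using (_∣_; ∣ᵤ⇒∣; ∣⇒∣ᵤ)
  open import Data.Product using (_,_)
  open import Data.Sum using (inj₁; inj₂)
  open import Function.Bundles using (mk⇔; Equivalence)
  import Function.Properties.Equivalence as ⇔
  open import Relation.Nullary using (yes; no)
  open import Relation.Binary.PropositionalEquality
    using (sym; trans; cong; cong₂; subst; subst₂; module ≡-Reasoning)
  open _ℕ∣_ using (quotient; equality)
  open Equivalence using (to; from)
  open LinearForm
  open QuantifierFree

  D : ℕ
  D = suc D′

  P-periodic-multiple : ∀ q {x} → T ≤ x → P x ⇔ P (x + q * D)
  P-periodic-multiple zero    {x} _   = subst (λ y → P x ⇔ P y) (sym (+-identityʳ x)) ⇔.refl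
  P-periodic-multiple (suc q) {x} T≤x = ⇔.trans (P-periodic-multiple q T≤x)
    (subst (λ y → P (x + q * D) ⇔ P y) (regroup x (q * D)) (P-periodic (x + q * D) (≤-trans T≤x (m≤m+n x _))))
    where
    regroup : ∀ x y → x + y + D ≡ x + (D + y)
    regroup x y = trans (+-assoc x y D) (cong (_+_ x) (+-comm y D))

  -- Below T the members are listed; from T on, membership depends only on the residue mod D.
  definingQF : ∀ {n} → Lin n → QF n
  definingQF t =
    anyBelow T (λ s → when (P? s) (t ≐ const (+ s))) ∨
    anyBelow D (λ r → when (P? (T + r)) (const (+ (T + r)) ≼ t ∧ dvd D′ (t ⊝ const (+ (T + r)))))

  eval-⊝-const : ∀ {n} (t : Lin n) ρ {v c} → eval ρ t ≡ + v → c ≤ v → eval ρ (t ⊝ const (+ c)) ≡ + (v ∸ c)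
  eval-⊝-const t ρ {v} {c} t≡v c≤v = begin
    eval ρ (t ⊝ const (+ c))        ≡⟨ eval-⊝ ρ t (const (+ c)) ⟩
    eval ρ t - eval ρ (const (+ c)) ≡⟨ cong₂ _-_ t≡v (eval-const ρ (+ c)) ⟩
    + v - + c                       ≡⟨ ℤ.m-n≡m⊖n v c ⟩
    v ⊖ c                           ≡⟨ ℤ.⊖-≥ c≤v ⟩
    + (v ∸ c)                       ∎
    where open ≡-Reasoning

  split-above : ∀ {v} → T ≤ v → v ≡ T + (v ∸ T) % D + (v ∸ T) / D * D
  split-above {v} T≤v = begin
    v                                     ≡⟨ m+[n∸m]≡n T≤v ⟨
    T + (v ∸ T)                           ≡⟨ cong (_+_ T) (m≡m%n+[m/n]*n (v ∸ T) D) ⟩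
    T + ((v ∸ T) % D + (v ∸ T) / D * D)   ≡⟨ +-assoc T _ _ ⟨
    T + (v ∸ T) % D + (v ∸ T) / D * D     ∎
    where open ≡-Reasoning

  definingQF-correct : ∀ {n} (t : Lin n) ρ {v} → eval ρ t ≡ + v → ⟦ definingQF t ⟧ ρ ⇔ P v
  definingQF-correct t ρ {v} t≡v = mk⇔ sound complete
    where
    above-T : ∀ r → P (T + r) → eval ρ (const (+ (T + r))) ≤ℤ eval ρ t →
      + D ∣ eval ρ (t ⊝ const (+ (T + r))) → P v
    above-T r Pc c≤t D∣t-c = subst P c+qD≡v (to (P-periodic-multiple (quotient D∣v-c) (m≤m+n T r)) Pc)
      where
      c≤v : T + r ≤ v
      c≤v = ℤ.drop‿+≤+ (subst₂ _≤ℤ_ (eval-const ρ (+ (T + r))) t≡v c≤t)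
      D∣v-c : D ℕ∣ v ∸ (T + r)
      D∣v-c = ∣⇒∣ᵤ (subst (+ D ∣_) (eval-⊝-const t ρ t≡v c≤v) D∣t-c)
      c+qD≡v : T + r + quotient D∣v-c * D ≡ v
      c+qD≡v = trans (cong (_+_ (T + r)) (sym (equality D∣v-c))) (m+[n∸m]≡n c≤v)
    sound : ⟦ definingQF t ⟧ ρ → P v
    sound (inj₁ p) with to (anyBelow-correct T _ ρ) p
    ... | s , _ , q with to (when-correct (P? s) _ ρ) q
    ... | Ps , t≐s =
      subst P (sym (ℤ.+-injective (trans (sym t≡v) (trans (to (≐-correct t _ ρ) t≐s) (eval-const ρ (+ s)))))) Ps
    sound (inj₂ p) with to (anyBelow-correct D _ ρ) p
    ... | r , _ , q with to (when-correct (P? (T + r)) _ ρ) q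
    ... | Pc , c≼t , D∣t-c = above-T r Pc (to (≼-correct _ t ρ) c≼t) D∣t-c
    complete : P v → ⟦ definingQF t ⟧ ρ
    complete Pv with v <? T
    ... | yes v<T = inj₁ (from (anyBelow-correct T _ ρ) (v , v<T , from (when-correct (P? v) _ ρ)
      (Pv , from (≐-correct t (const (+ v)) ρ) (trans t≡v (sym (eval-const ρ (+ v)))))))
    ... | no v≮T = inj₂ (from (anyBelow-correct D _ ρ) (r , m%n<n (v ∸ T) D , from (when-correct (P? c) _ ρ)
      (Pc , from (≼-correct _ t ρ) c≤t ,
            subst (+ D ∣_) (sym (eval-⊝-const t ρ t≡v c≤v)) (∣ᵤ⇒∣ (divides q v-c≡qD)))))
      where
      r q c : ℕ
      r = (v ∸ T) % D
      q = (v ∸ T) / D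
      c = T + r
      v≡c+qD : v ≡ c + q * D
      v≡c+qD = split-above (≮⇒≥ v≮T)
      Pc : P c
      Pc = from (P-periodic-multiple q (m≤m+n T r)) (subst P v≡c+qD Pv)
      c≤v : c ≤ v
      c≤v = subst (c ≤_) (sym v≡c+qD) (m≤m+n c _)
      c≤t : eval ρ (const (+ c)) ≤ℤ eval ρ t
      c≤t = subst₂ _≤ℤ_ (sym (eval-const ρ (+ c))) (sym t≡v) (+≤+ c≤v)
      v-c≡qD : v ∸ c ≡ q * D
      v-c≡qD = trans (cong (_∸ c) v≡c+qD) (m+n∸m≡n c _)

module Presburger (u : ℕ → ℕ) (∈u? : ∀ x → Dec (∃[ k ] u k ≡ x)) (T D′ : ℕ)
  (∈u-periodic : ∀ x → T ℕ.≤ x → (∃[ k ] u k ≡ x) ⇔ (∃[ k ] u k ≡ x ℕ.+ suc D′)) where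

  open import Data.Integer using (ℤ; +_; 0ℤ; 1ℤ; _+_; _≤_; +≤+; ∣_∣)
  import Data.Integer.Properties as ℤ
  open import Data.Fin using (Fin)
  open import Data.Vec using (Vec; _∷_; tabulate)
  open import Data.Vec.Properties using (lookup∘tabulate)
  open import Data.Product using (_,_; map₂)
  open import Data.Product.Function.NonDependent.Propositional using (_×-⇔_)
  open import Data.Sum using (_⊎_; inj₁; inj₂)
  open import Data.Sum.Function.Propositional using (_⊎-⇔_)
  open import Data.Empty using (⊥-elim)
  open import Function.Bundles using (mk⇔; Equivalence)
  import Function.Properties.Equivalence as ⇔
  open import Function.Related.TypeIsomorphisms using (→-cong-⇔; ¬-cong-⇔)
  open import Relation.Nullary using (¬_; yes; no)
  import Relation.Nullary.Decidable as Dec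
  open import Relation.Nullary.Decidable using (decidable-stable)
  open import Relation.Binary.PropositionalEquality using (sym; trans; cong; cong₂; subst; subst₂)
  open import Defs using (Term; var; `0; `1; _`+_; Formula; _`≡_; `Ulam; `⊥; `¬_; _`∧_; _`∨_; _`⇒_; `∀_; `∃_;
                          evalT; Sat; extend)
  open Equivalence using (to; from)
  open LinearForm hiding (var)
  open QuantifierFree
  open Cooper using (cooper; cooper-correct)
  open EventuallyPeriodic ∈u? T D′ ∈u-periodic using (definingQF; definingQF-correct)

  linTerm : ∀ {k} → Term k → Lin k
  linTerm (var i)  = LinearForm.var i
  linTerm `0       = const 0ℤ
  linTerm `1       = const 1ℤ
  linTerm (s `+ t) = linTerm s ⊕ linTerm t

  env : ∀ {k} → (Fin k → ℕ) → Vec ℤ k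
  env ρ = tabulate (λ i → + ρ i)

  eval-linTerm : ∀ {k} (ρ : Fin k → ℕ) t → eval (env ρ) (linTerm t) ≡ + evalT ρ t
  eval-linTerm ρ (var i)  = trans (eval-var (env ρ) i) (lookup∘tabulate (λ i → + ρ i) i)
  eval-linTerm ρ `0       = eval-const (env ρ) 0ℤ
  eval-linTerm ρ `1       = eval-const (env ρ) 1ℤ
  eval-linTerm ρ (s `+ t) =
    trans (eval-⊕ (env ρ) (linTerm s) (linTerm t)) (cong₂ _+_ (eval-linTerm ρ s) (eval-linTerm ρ t))

  nonneg : ∀ {n} → QF (suc n)
  nonneg = const 0ℤ ≼ LinearForm.var Fin.zero

  nonneg-correct : ∀ {n} z (ρ : Vec ℤ n) → ⟦ nonneg ⟧ (z ∷ ρ) ⇔ (0ℤ ≤ z)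
  nonneg-correct z ρ = subst₂ (λ a b → ⟦ nonneg ⟧ (z ∷ ρ) ⇔ (a ≤ b)) (eval-const (z ∷ ρ) 0ℤ)
    (eval-var (z ∷ ρ) Fin.zero) (≼-correct (const 0ℤ) (LinearForm.var Fin.zero) (z ∷ ρ))

  cooperℕ : ∀ {n} → QF (suc n) → QF n
  cooperℕ φ = cooper (nonneg ∧ φ)

  cooperℕ-correct : ∀ {n} (φ : QF (suc n)) ρ → ⟦ cooperℕ φ ⟧ ρ ⇔ (∃[ x ] ⟦ φ ⟧ (+ x ∷ ρ))
  cooperℕ-correct φ ρ = ⇔.trans (cooper-correct (nonneg ∧ φ) ρ) (mk⇔
    (λ (z , 0≤z , φz) →
      ∣ z ∣ , subst (λ w → ⟦ φ ⟧ (w ∷ ρ)) (sym (ℤ.0≤i⇒+∣i∣≡i (to (nonneg-correct z ρ) 0≤z))) φz)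
    (λ (x , φx) → + x , from (nonneg-correct (+ x) ρ) (+≤+ ℕ.z≤n) , φx))

  toQF : ∀ {k} → Formula k → QF k
  toQF (s `≡ t)  = linTerm s ≐ linTerm t
  toQF (`Ulam t) = definingQF (linTerm t)
  toQF `⊥        = false
  toQF (`¬ φ)    = negate (toQF φ)
  toQF (φ `∧ ψ)  = toQF φ ∧ toQF ψ
  toQF (φ `∨ ψ)  = toQF φ ∨ toQF ψ
  toQF (φ `⇒ ψ)  = negate (toQF φ) ∨ toQF ψ
  toQF (`∀ φ)    = negate (cooperℕ (negate (toQF φ)))
  toQF (`∃ φ)    = cooperℕ (toQF φ)

  →⇔¬⊎ : ∀ {A B : Set} → Dec A → (A → B) ⇔ (¬ A ⊎ B)
  →⇔¬⊎ (yes a) = mk⇔ (λ f → inj₂ (f a)) λ { (inj₁ ¬a) a → ⊥-elim (¬a a) ; (inj₂ b) _ → b }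
  →⇔¬⊎ (no ¬a) = mk⇔ (λ _ → inj₁ ¬a) λ { (inj₁ _) a → ⊥-elim (¬a a) ; (inj₂ b) _ → b }

  toQF-correct : ∀ {k} (φ : Formula k) ρ → Sat u φ ρ ⇔ ⟦ toQF φ ⟧ (env ρ)
  toQF-correct (s `≡ t)  ρ = ⇔.trans
    (subst₂ (λ a b → (evalT ρ s ≡ evalT ρ t) ⇔ (a ≡ b)) (sym (eval-linTerm ρ s)) (sym (eval-linTerm ρ t))
      (mk⇔ (cong (+_)) ℤ.+-injective))
    (⇔.sym (≐-correct (linTerm s) (linTerm t) (env ρ)))
  toQF-correct (`Ulam t) ρ = ⇔.sym (definingQF-correct (linTerm t) (env ρ) (eval-linTerm ρ t))
  toQF-correct `⊥        ρ = ⇔.refl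
  toQF-correct (`¬ φ)    ρ = ⇔.trans (¬-cong-⇔ (toQF-correct φ ρ)) (⇔.sym (negate-correct (toQF φ) (env ρ)))
  toQF-correct (φ `∧ ψ)  ρ = toQF-correct φ ρ ×-⇔ toQF-correct ψ ρ
  toQF-correct (φ `∨ ψ)  ρ = toQF-correct φ ρ ⊎-⇔ toQF-correct ψ ρ
  toQF-correct (φ `⇒ ψ)  ρ = ⇔.trans (→-cong-⇔ (toQF-correct φ ρ) (toQF-correct ψ ρ))
    (⇔.trans (→⇔¬⊎ (⟦ toQF φ ⟧? (env ρ))) (⇔.sym (negate-correct (toQF φ) (env ρ)) ⊎-⇔ ⇔.refl))
  -- ∀ is read as ¬ ∃ ¬, which is constructively valid because ⟦ toQF φ ⟧ is decidable.
  toQF-correct (`∀ φ)    ρ = mk⇔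
    (λ ∀φ → from (negate-correct _ (env ρ)) λ ∃¬φ →
      let x , ¬φx = to (cooperℕ-correct _ (env ρ)) ∃¬φ
      in to (negate-correct (toQF φ) _) ¬φx (to (toQF-correct φ (extend x ρ)) (∀φ x)))
    (λ ¬∃¬φ x → from (toQF-correct φ (extend x ρ)) (decidable-stable (⟦ toQF φ ⟧? _) λ ¬φx →
      to (negate-correct _ (env ρ)) ¬∃¬φ
        (from (cooperℕ-correct _ (env ρ)) (x , from (negate-correct (toQF φ) _) ¬φx))))
  toQF-correct (`∃ φ)    ρ = ⇔.trans
    (mk⇔ (map₂ λ {x} → to (toQF-correct φ (extend x ρ))) (map₂ λ {x} → from (toQF-correct φ (extend x ρ))))
    (⇔.sym (cooperℕ-correct (toQF φ) (env ρ)))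

  Sat? : ∀ {k} (φ : Formula k) ρ → Dec (Sat u φ ρ)
  Sat? φ ρ = Dec.map (⇔.sym (toQF-correct φ ρ)) (⟦ toQF φ ⟧? (env ρ))

module Counting where

  open import Data.Nat using (zero; _+_; _≤_; _<_; z≤n; s≤s⁻¹)
  open import Data.Nat.Properties using (≤-refl; <⇒≱; +-identityʳ; +-comm; n<1+n; m<n⇒m<1+n; m≤n⇒m<n∨m≡n)
  open import Data.List using ([_]; length; filter; upTo)
  open import Data.List.Properties using (upTo-∷ʳ; filter-++; length-++; filter-accept; filter-reject)
  open import Data.Sum using (inj₁; inj₂)
  open import Function using (_∘_)
  open import Function.Bundles using (mk⇔; Equivalence)
  open import Relation.Unary using (Decidable)
  open import Relation.Binary.PropositionalEquality using (refl; sym; trans; cong; cong₂)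
  open Equivalence using (to; from)

  length-filter-upTo-suc : ∀ {Q : ℕ → Set} (Q? : Decidable Q) L →
    length (filter Q? (upTo (suc L))) ≡ length (filter Q? (upTo L)) + length (filter Q? [ L ])
  length-filter-upTo-suc Q? L = trans (cong (length ∘ filter Q?) (sym (upTo-∷ʳ L)))
    (trans (cong length (filter-++ Q? (upTo L) [ L ])) (length-++ (filter Q? (upTo L))))

  length-filter-upTo : ∀ {Q : ℕ → Set} (Q? : Decidable Q) {L m} → m ≤ L →
    (∀ k → k < L → Q k ⇔ k < m) → length (filter Q? (upTo L)) ≡ m
  length-filter-upTo Q? {zero} z≤n _ = refl
  length-filter-upTo Q? {suc L} {m} m≤1+L Q⇔ with m≤n⇒m<n∨m≡n m≤1+L
  ... | inj₁ m<1+L = trans (length-filter-upTo-suc Q? L) (trans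
    (cong₂ _+_ (length-filter-upTo Q? (s≤s⁻¹ m<1+L) (λ k k<L → Q⇔ k (m<n⇒m<1+n k<L)))
               (cong length (filter-reject Q? λ QL → <⇒≱ (to (Q⇔ L (n<1+n L)) QL) (s≤s⁻¹ m<1+L))))
    (+-identityʳ m))
  ... | inj₂ refl  = trans (length-filter-upTo-suc Q? L) (trans
    (cong₂ _+_ (length-filter-upTo Q? ≤-refl λ k k<L →
                 mk⇔ (λ _ → k<L) (λ _ → from (Q⇔ k (m<n⇒m<1+n k<L)) (m<n⇒m<1+n k<L)))
               (cong length (filter-accept Q? (from (Q⇔ L (n<1+n L)) (n<1+n L)))))
    (+-comm L 1))

module StrictlyIncreasing (u : ℕ → ℕ) (u-step : ∀ k → u k ℕ.< u (suc k)) where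

  open import Data.Nat using (zero; _≤_; _<_; _≤′_; ≤′-refl; ≤′-step; z≤n; s≤s; s≤s⁻¹; _≟_; _≤?_)
  open import Data.Nat.Properties
  open import Data.Fin using (toℕ; fromℕ<)
  open import Data.Fin.Properties using (any?; toℕ-fromℕ<)
  open import Data.Product using (_,_)
  open import Data.Sum using (inj₁; inj₂)
  open import Data.Empty using (⊥-elim)
  open import Function using (_∘_)
  open import Function.Bundles using (mk⇔; Equivalence)
  open import Relation.Nullary using (yes; no)
  import Relation.Nullary.Decidable as Dec
  open import Relation.Binary.PropositionalEquality using (refl; sym; trans; cong; subst)
  open import Defs using (countUpTo)
  open Equivalence using (to; from)
  open Counting

  u-mono-< : ∀ {i j} → i < j → u i < u j
  u-mono-< i<j = mono (≤⇒≤′ i<j)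
    where
    mono : ∀ {i j} → suc i ≤′ j → u i < u j
    mono ≤′-refl         = u-step _
    mono (≤′-step 1+i≤j) = <-trans (mono 1+i≤j) (u-step _)

  u-mono-≤ : ∀ {i j} → i ≤ j → u i ≤ u j
  u-mono-≤ i≤j with m≤n⇒m<n∨m≡n i≤j
  ... | inj₁ i<j  = <⇒≤ (u-mono-< i<j)
  ... | inj₂ refl = ≤-refl

  u-cancel-≤ : ∀ {i j} → u i ≤ u j → i ≤ j
  u-cancel-≤ uᵢ≤uⱼ = ≮⇒≥ λ j<i → <⇒≱ (u-mono-< j<i) uᵢ≤uⱼ

  u-cancel-< : ∀ {i j} → u i < u j → i < j
  u-cancel-< uᵢ<uⱼ = ≰⇒> λ j≤i → <⇒≱ uᵢ<uⱼ (u-mono-≤ j≤i)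

  k≤u[k] : ∀ k → k ≤ u k
  k≤u[k] zero    = z≤n
  k≤u[k] (suc k) = ≤-<-trans (k≤u[k] k) (u-step k)

  -- A term equal to x has index at most x, so a search through Fin (suc x) decides membership.
  ∈u? : ∀ x → Dec (∃[ k ] u k ≡ x)
  ∈u? x = Dec.map
    (mk⇔ (λ (i , e) → toℕ i , e) (λ (k , e) → fromℕ< (k<1+x e) , trans (cong u (toℕ-fromℕ< _)) e))
    (any? λ i → u (toℕ i) ≟ x)
    where
    k<1+x : ∀ {k} → u k ≡ x → k < suc x
    k<1+x {k} e = s≤s (subst (k ≤_) e (k≤u[k] k))

  IsCount : ℕ → ℕ → Set
  IsCount n m = ∀ k → u k ≤ n ⇔ k < m

  IsCount-unique : ∀ {n m m′} → IsCount n m → IsCount n m′ → m ≡ m′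
  IsCount-unique c c′ = ≤-antisym (≮⇒≥ λ m′<m → <-irrefl refl (to (c′ _) (from (c _) m′<m)))
                                  (≮⇒≥ λ m<m′ → <-irrefl refl (to (c _) (from (c′ _) m<m′)))

  count-exists : 0 < u 0 → ∀ n → ∃[ m ] IsCount n m
  count-exists 0<u₀ zero    = 0 , λ k → mk⇔ (λ uₖ≤0 → ⊥-elim (<⇒≱ (<-≤-trans 0<u₀ (u-mono-≤ z≤n)) uₖ≤0)) λ ()
  count-exists 0<u₀ (suc n) with count-exists 0<u₀ n
  ... | m , c with u m ≟ suc n
  ... | yes uₘ≡1+n = suc m , λ k → mk⇔
    (λ uₖ≤1+n → s≤s (u-cancel-≤ (subst (u k ≤_) (sym uₘ≡1+n) uₖ≤1+n)))
    (λ k<1+m → subst (u k ≤_) uₘ≡1+n (u-mono-≤ (s≤s⁻¹ k<1+m)))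
  ... | no  uₘ≢1+n = m , λ k → mk⇔
    (λ uₖ≤1+n → u-cancel-< (≤-<-trans uₖ≤1+n 1+n<uₘ))
    (λ k<m → m≤n⇒m≤1+n (from (c k) k<m))
    where
    1+n<uₘ : suc n < u m
    1+n<uₘ = ≤∧≢⇒< (≰⇒> λ uₘ≤n → <-irrefl refl (to (c m) uₘ≤n)) (uₘ≢1+n ∘ sym)

  countUpTo-IsCount : 0 < u 0 → ∀ n → IsCount n (countUpTo u n)
  countUpTo-IsCount 0<u₀ n with count-exists 0<u₀ n
  ... | m , c = subst (IsCount n) (sym (length-filter-upTo (λ k → u k ≤? n) m≤1+n (λ k _ → c k))) c
    where
    m≤1+n : m ≤ suc n
    m≤1+n = ≮⇒≥ λ 1+n<m → <⇒≱ (s≤s (k≤u[k] (suc n))) (s≤s (from (c (suc n)) 1+n<m))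

module Periodicity where

  open import Data.Nat using (_+_; _∸_; _≤_; _<_; _<?_; NonZero; >-nonZero⁻¹)
  open import Data.Nat.Properties using (≮⇒≥; m∸n+n≡m; ∸-monoʳ-<; m+n≤o⇒m≤o∸n; m+n≤o⇒n≤o)
  open import Data.Nat.Induction using (<-rec)
  open import Relation.Nullary using (yes; no)
  open import Relation.Binary.PropositionalEquality using (sym; trans; cong; subst)

  periodic-bounded : ∀ (f : ℕ → ℕ) {T D C} .{{_ : NonZero D}} → (∀ n → T ≤ n → f (n + D) ≡ f n) →
    (∀ n → n < T + D → f n ≤ C) → ∀ n → f n ≤ C
  periodic-bounded f {T} {D} {C} periodic initial = <-rec _ bound
    where
    bound : ∀ n → (∀ {m} → m < n → f m ≤ C) → f n ≤ C
    bound n rec with n <? T + D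
    ... | yes n<T+D = initial n n<T+D
    ... | no  n≮T+D = subst (_≤ C) (trans (sym (periodic (n ∸ D) T≤n∸D)) (cong f (m∸n+n≡m D≤n)))
                        (rec (∸-monoʳ-< (>-nonZero⁻¹ D) D≤n))
      where
      T≤n∸D : T ≤ n ∸ D
      T≤n∸D = m+n≤o⇒m≤o∸n T (≮⇒≥ n≮T+D)
      D≤n : D ≤ n
      D≤n = m+n≤o⇒n≤o T (≮⇒≥ n≮T+D)

module PeriodicGaps (u : ℕ → ℕ) (u-step : ∀ k → u k ℕ.< u (suc k)) (N p : ℕ) (gaps : GapsPeriodic u N p) where

  open import Data.Nat using (_+_; _*_; _∸_; _⊔_; _≤_; _<_; _≤′_; ≤′-refl; ≤′-step; _<?_; _≤?_)
  open import Data.Nat.Properties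
  open import Data.Nat.Tactic.RingSolver using (solve-∀)
  open import Data.Integer using (_⊖_; ∣_∣)
  import Data.Integer.Properties as ℤ
  open import Data.List using (upTo)
  open import Data.List.Properties using (length-filter; length-upTo)
  open import Data.Product using (_×_; _,_; proj₁; proj₂)
  open import Function.Bundles using (mk⇔; Equivalence)
  open import Relation.Nullary using (yes; no)
  open import Relation.Binary.PropositionalEquality
    using (refl; sym; trans; cong; cong₂; subst; subst₂; module ≡-Reasoning)
  open import Defs using (gap; countUpTo)
  open Equivalence using (to; from)
  open StrictlyIncreasing u u-step
  open Periodicity

  T D′ D : ℕ
  T  = u N
  D′ = u (N + p) ∸ suc T
  D  = suc D′

  u[N+p]≡T+D : u (N + p) ≡ T + D
  u[N+p]≡T+D = trans (sym (m+[n∸m]≡n (u-mono-< (m<m+n N (proj₁ gaps))))) (sym (+-suc T D′))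

  u-suc : ∀ k → u (suc k) ≡ u k + gap u k
  u-suc k = sym (m+[n∸m]≡n (<⇒≤ (u-step k)))

  u-shift : ∀ {k} → N ≤ k → u (k + p) ≡ u k + D
  u-shift N≤k = shift (≤⇒≤′ N≤k)
    where
    open ≡-Reasoning
    shift : ∀ {k} → N ≤′ k → u (k + p) ≡ u k + D
    shift ≤′-refl = u[N+p]≡T+D
    shift {suc k} (≤′-step N≤′k) = begin
      u (suc k + p)               ≡⟨ u-suc (k + p) ⟩
      u (k + p) + gap u (k + p)   ≡⟨ cong₂ _+_ (shift N≤′k) (proj₂ gaps k (≤′⇒≤ N≤′k)) ⟩
      u k + D + gap u k           ≡⟨ +-assoc (u k) D (gap u k) ⟩
      u k + (D + gap u k)         ≡⟨ cong (_+_ (u k)) (+-comm D (gap u k)) ⟩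
      u k + (gap u k + D)         ≡⟨ +-assoc (u k) (gap u k) D ⟨
      u k + gap u k + D           ≡⟨ cong (_+ D) (u-suc k) ⟨
      u (suc k) + D               ∎

  unshift : ∀ {k′} → N + p ≤ k′ → ∃[ k ] N ≤ k × k + p ≡ k′
  unshift {k′} N+p≤k′ =
    k′ ∸ p , subst (_≤ k′ ∸ p) (m+n∸n≡m N p) (∸-monoˡ-≤ p N+p≤k′) , m∸n+n≡m (≤-trans (m≤n+m p N) N+p≤k′)

  ∈u-periodic : ∀ x → T ≤ x → (∃[ k ] u k ≡ x) ⇔ (∃[ k ] u k ≡ x + D)
  ∈u-periodic x T≤x = mk⇔
    (λ (k , uₖ≡x) → k + p , trans (u-shift (u-cancel-≤ (subst (T ≤_) (sym uₖ≡x) T≤x))) (cong (_+ D) uₖ≡x))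
    (λ (k′ , uₖ′≡x+D) → shift-back k′ uₖ′≡x+D)
    where
    shift-back : ∀ k′ → u k′ ≡ x + D → ∃[ k ] u k ≡ x
    shift-back k′ uₖ′≡x+D
      with unshift (u-cancel-≤ (subst₂ _≤_ (sym u[N+p]≡T+D) (sym uₖ′≡x+D) (+-monoˡ-≤ D T≤x)))
    ... | k , N≤k , refl = k , +-cancelʳ-≡ D (u k) x (trans (sym (u-shift N≤k)) uₖ′≡x+D)

  IsCount-shift : ∀ {n m} → T ≤ n → IsCount n m → IsCount (n + D) (m + p)
  IsCount-shift {n} {m} T≤n c k with k <? N + p
  ... | yes k<N+p = mk⇔
    (λ _ → <-≤-trans k<N+p (+-monoˡ-≤ p (<⇒≤ (to (c N) T≤n))))
    (λ _ → ≤-trans (u-mono-≤ (<⇒≤ k<N+p)) (subst (_≤ n + D) (sym u[N+p]≡T+D) (+-monoˡ-≤ D T≤n)))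
  ... | no k≮N+p with unshift (≮⇒≥ k≮N+p)
  ... | j , N≤j , refl = mk⇔
    (λ uⱼ₊ₚ≤n+D → +-monoˡ-< p (to (c j) (+-cancelʳ-≤ D (u j) n (subst (_≤ n + D) (u-shift N≤j) uⱼ₊ₚ≤n+D))))
    (λ j+p<m+p → subst (_≤ n + D) (sym (u-shift N≤j)) (+-monoˡ-≤ D (from (c j) (+-cancelʳ-< p j m j+p<m+p))))

  countUpTo-shift : 0 < u 0 → ∀ {n} → T ≤ n → countUpTo u (n + D) ≡ countUpTo u n + p
  countUpTo-shift 0<u₀ {n} T≤n =
    IsCount-unique (countUpTo-IsCount 0<u₀ (n + D)) (IsCount-shift T≤n (countUpTo-IsCount 0<u₀ n))

  discrepancy : ℕ → ℕ
  discrepancy n = ∣ countUpTo u n * D ⊖ p * n ∣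

  discrepancy-periodic : 0 < u 0 → ∀ n → T ≤ n → discrepancy (n + D) ≡ discrepancy n
  discrepancy-periodic 0<u₀ n T≤n = cong ∣_∣ (begin
    countUpTo u (n + D) * D ⊖ p * (n + D)       ≡⟨ cong (λ c → c * D ⊖ p * (n + D)) (countUpTo-shift 0<u₀ T≤n) ⟩
    (countUpTo u n + p) * D ⊖ p * (n + D)       ≡⟨ cong₂ _⊖_ (expand₁ (countUpTo u n) p D) (expand₂ p n D) ⟩
    p * D + countUpTo u n * D ⊖ (p * D + p * n) ≡⟨ ℤ.+-cancelˡ-⊖ (p * D) _ _ ⟩
    countUpTo u n * D ⊖ p * n                   ∎)
    where
    open ≡-Reasoning
    expand₁ : ∀ c p D → (c + p) * D ≡ p * D + c * D
    expand₁ = solve-∀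
    expand₂ : ∀ p n D → p * (n + D) ≡ p * D + p * n
    expand₂ = solve-∀

  discrepancyBound : ℕ
  discrepancyBound = (T + D) * D + p * (T + D)

  discrepancy-bounded : 0 < u 0 → ∀ n → discrepancy n ≤ discrepancyBound
  discrepancy-bounded 0<u₀ = periodic-bounded discrepancy (discrepancy-periodic 0<u₀) initial
    where
    count≤1+n : ∀ n → countUpTo u n ≤ suc n
    count≤1+n n = subst (countUpTo u n ≤_) (length-upTo (suc n)) (length-filter (λ k → u k ≤? n) (upTo (suc n)))
    initial : ∀ n → n < T + D → discrepancy n ≤ discrepancyBound
    initial n n<T+D = begin
      ∣ countUpTo u n * D ⊖ p * n ∣  ≤⟨ ℤ.∣m⊝n∣≤m⊔n (countUpTo u n * D) (p * n) ⟩
      countUpTo u n * D ⊔ p * n      ≤⟨ m⊔n≤m+n (countUpTo u n * D) (p * n) ⟩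
      countUpTo u n * D + p * n      ≤⟨ +-mono-≤ (*-monoˡ-≤ D (≤-trans (count≤1+n n) n<T+D))
                                                   (*-monoʳ-≤ p (<⇒≤ n<T+D)) ⟩
      (T + D) * D + p * (T + D)      ∎
      where open ≤-Reasoning

module RationalApproximation where

  open import Data.Integer as ℤ using (+_; +[1+_]; -[1+_]; _⊖_; +<+)
  import Data.Integer.Properties as ℤ
  import Data.Nat.Properties as ℕ
  open import Data.Rational using (ℚ; mkℚ; _/_; _-_; -_; ∣_∣; 0ℚ; _<_; *<*; toℚᵘ)
  open import Data.Rational.Properties
    using (toℚᵘ-homo-∣-∣; toℚᵘ-homo-+; toℚᵘ-homo‿-; toℚᵘ-fromℚᵘ; toℚᵘ-cancel-<)
  open import Data.Rational.Unnormalised as ℚᵘ using (mkℚᵘ; _≃_)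
  import Data.Rational.Unnormalised.Properties as ℚᵘ
  open import Relation.Binary.PropositionalEquality using (sym; trans; cong; cong₂; subst₂)

  toℚᵘ-∣a/m-b/n∣ : ∀ a b m n → toℚᵘ ∣ a / suc m - b / suc n ∣ ≃ ℚᵘ.∣ mkℚᵘ a m ℚᵘ.- mkℚᵘ b n ∣
  toℚᵘ-∣a/m-b/n∣ a b m n = ℚᵘ.≃-trans (toℚᵘ-homo-∣-∣ (a / suc m - b / suc n)) (ℚᵘ.∣-∣-cong
    (ℚᵘ.≃-trans (toℚᵘ-homo-+ (a / suc m) (- (b / suc n)))
      (ℚᵘ.+-cong (toℚᵘ-fromℚᵘ (mkℚᵘ a m))
        (ℚᵘ.≃-trans (toℚᵘ-homo‿- (b / suc n)) (ℚᵘ.-‿cong (toℚᵘ-fromℚᵘ (mkℚᵘ b n)))))))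

  numerator≡ : ∀ c p m n → + c ℤ.* + suc n ℤ.+ ℤ.- + p ℤ.* + suc m ≡ c ℕ.* suc n ⊖ p ℕ.* suc m
  numerator≡ c p m n = trans
    (cong₂ ℤ._+_ (sym (ℤ.pos-* c (suc n)))
                 (trans (sym (ℤ.neg-distribˡ-* (+ p) (+ suc m))) (cong ℤ.-_ (sym (ℤ.pos-* p (suc m))))))
    (ℤ.m-n≡m⊖n (c ℕ.* suc n) (p ℕ.* suc m))

  -- ∣ c/(m+1) - p/(n+1) ∣ = ∣ c (n+1) - p (m+1) ∣ / ((m+1) (n+1)) < 1/(d+1) ≤ (e+1)/(d+1)
  ∣c/m-p/n∣ᵘ< : ∀ c p m n e d → ℤ.∣ c ℕ.* suc n ⊖ p ℕ.* suc m ∣ ℕ.* suc d ℕ.< suc m →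
    ℚᵘ.∣ mkℚᵘ (+ c) m ℚᵘ.- mkℚᵘ (+ p) n ∣ ℚᵘ.< mkℚᵘ +[1+ e ] d
  ∣c/m-p/n∣ᵘ< c p m n e d B*d<m = ℚᵘ.*<* (subst₂ ℤ._<_
    (trans (ℤ.pos-* ℤ.∣ c ℕ.* suc n ⊖ p ℕ.* suc m ∣ (suc d))
           (cong (λ z → + ℤ.∣ z ∣ ℤ.* + suc d) (sym (numerator≡ c p m n))))
    (ℤ.pos-* (suc e) (suc m ℕ.* suc n))
    (+<+ (ℕ.<-≤-trans B*d<m (ℕ.≤-trans (ℕ.m≤m*n (suc m) (suc n)) (ℕ.m≤n*m (suc m ℕ.* suc n) (suc e))))))

  ∣c/m-p/n∣<ε : ∀ c p m n (ε : ℚ) → 0ℚ < ε →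
    ℤ.∣ c ℕ.* suc n ⊖ p ℕ.* suc m ∣ ℕ.* suc (ℚ.denominator-1 ε) ℕ.< suc m →
    ∣ + c / suc m - + p / suc n ∣ < ε
  ∣c/m-p/n∣<ε c p m n (mkℚ +[1+ e ] d _) _ B*d<m = toℚᵘ-cancel-<
    (ℚᵘ.<-respˡ-≃ (ℚᵘ.≃-sym (toℚᵘ-∣a/m-b/n∣ (+ c) (+ p) m n)) (∣c/m-p/n∣ᵘ< c p m n e d B*d<m))
  ∣c/m-p/n∣<ε c p m n (mkℚ (+ 0)    d _) (*<* (+<+ ())) _
  ∣c/m-p/n∣<ε c p m n (mkℚ -[1+ _ ] d _) (*<* ())       _

open import Defs
open import Data.Nat using (ℕ; suc; _≤_; _<_)
open import Data.Nat.Coprimality using (Coprime)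
open import Data.Fin using (Fin)
open import Data.Integer using (+_)
open import Data.Rational using (ℚ; _/_; _-_; ∣_∣; 0ℚ) renaming (_<_ to _<ℚ_)
open import Data.Product using (Σ; _×_)
open import Relation.Nullary using (Dec)

open import Data.Nat using (zero; _*_; z≤n; s≤s)
open import Data.Nat.Properties using (≤-trans; *-monoˡ-≤)
open import Data.Product using (_,_; proj₁)
open import Relation.Binary.PropositionalEquality using (sym; subst; subst₂)
open RationalApproximation using (∣c/m-p/n∣<ε)

IsUlam-increasing : ∀ {a b u} → a < b → IsUlam a b u → ∀ k → u k < u (suc k)
IsUlam-increasing a<b (u₀≡a , u₁≡b , _) zero    = subst₂ _<_ (sym u₀≡a) (sym u₁≡b) a<b
IsUlam-increasing a<b (_ , _ , later)     (suc k) = proj₁ (later (suc (suc k)) (s≤s (s≤s z≤n)))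

proposition7p28 :
    (a b : ℕ) → 1 ≤ a → a < b → Coprime a b →
    (u : ℕ → ℕ) → IsUlam a b u →
    (N p : ℕ) → GapsPeriodic u N p →
    (Σ ℚ λ d → (ε : ℚ) → 0ℚ <ℚ ε → Σ ℕ λ M → (n : ℕ) → M ≤ n →
        ∣ ((+ countUpTo u (suc n)) / suc n) - d ∣ <ℚ ε)
    × ((φ : Formula 0) → Dec (Sat u φ emptyEnv))
    × ((k : ℕ) → (φ : Formula k) → (ρ : Fin k → ℕ) → Dec (Sat u φ ρ))
proposition7p28 a b 1≤a a<b _ u isUlam N p gaps =
  (+ p / D , density) , (λ φ → Sat? φ emptyEnv) , (λ _ → Sat?)
  where
  open PeriodicGaps u (IsUlam-increasing a<b isUlam) N p gaps
  open StrictlyIncreasing u (IsUlam-increasing a<b isUlam) using (∈u?)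
  open Presburger u ∈u? T D′ ∈u-periodic using (Sat?)
  0<u₀ : 0 < u 0
  0<u₀ = subst (0 <_) (sym (proj₁ isUlam)) 1≤a
  density : (ε : ℚ) → 0ℚ <ℚ ε → Σ ℕ λ M → (n : ℕ) → M ≤ n → ∣ + countUpTo u (suc n) / suc n - + p / D ∣ <ℚ ε
  density ε 0<ε = discrepancyBound * suc (ℚ.denominator-1 ε) , λ n M≤n →
    ∣c/m-p/n∣<ε (countUpTo u (suc n)) p n D′ ε 0<ε
      (s≤s (≤-trans (*-monoˡ-≤ (suc (ℚ.denominator-1 ε)) (discrepancy-bounded 0<u₀ (suc n))) M≤n))
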